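{- Let $M$ be a finite matroid and let $\mathcal{C} = \{F_i : i \in I\}$ be a finite collection (multiset) of flats of $M$. Then there exists a collection (multiset) of flats $\mathcal{C}'$ of $M$ such that $|\mathcal{C}'| = |\mathcal{C}|$, $\Delta(\mathcal{C}') \geq \Delta(\mathcal{C})$, and every element of $\mathcal{C}'$ is a cyclic flat.
   Context: $M$ has ground set $N$ and rank function $r$; a flat is a set $F$ with $r(F\cup\{n\})>r(F)$ for all $n\in N\setminus F$. A set $S$ is cyclic if $r(S\setminus\{n\}) = r(S)$ for every $n \in S$; a cyclic flat is a flat that is cyclic. For a collection $\mathcal{C} = \{F_i : i \in I\}$ of flats (repetitions allowed, counted in $|\mathcal{C}|$), put $F_S = \bigcap_{i\in S} F_i$ for $\emptyset \neq S \subseteq I$ and $F_\emptyset = \bigcup_{i\in I} F_i$, and $\Delta(\mathcal{C}) = \sum_{S \subseteq I} (-1)^{|S|} r(F_S)$. -}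

module Defs where

open import Data.Nat using (ℕ; zero; suc; _≤_; _<_)
open import Data.Integer using (ℤ; +_; -_; _+_)
open import Data.Bool using (Bool; true; false; if_then_else_)
open import Data.Fin using (Fin; zero; suc)
open import Data.Fin.Subset using (Subset; inside; outside; _∈_; _∉_; _⊆_; _∩_; _∪_; ∁; ⁅_⁆; ⊥; ⊤; ∣_∣)
open import Data.Vec using ([]; _∷_)
open import Data.List using (List; []; _∷_; _++_; map; foldr)
open import Relation.Binary.PropositionalEquality using (_≡_)
open import Data.Product using (_×_)

record Matroid (n : ℕ) : Set where
  field
    rank      : Subset n → ℕ
    rank-≤card : ∀ X → rank X ≤ ∣ X ∣
    rank-mono : ∀ {X Y} → X ⊆ Y → rank X ≤ rank Y
    rank-submod : ∀ X Y → rank (X ∪ Y) Data.Nat.+ rank (X ∩ Y) ≤ rank X Data.Nat.+ rank Y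
open Matroid public

module _ {n : ℕ} (M : Matroid n) where
  IsFlat : Subset n → Set
  IsFlat F = ∀ x → x ∉ F → rank M F < rank M (F ∪ ⁅ x ⁆)

  IsCyclic : Subset n → Set
  IsCyclic S = ∀ x → x ∈ S → rank M (S ∩ ∁ ⁅ x ⁆) ≡ rank M S

  IsCyclicFlat : Subset n → Set
  IsCyclicFlat F = IsFlat F × IsCyclic F

allSubsets : (k : ℕ) → List (Subset k)
allSubsets zero = [] ∷ []
allSubsets (suc k) = map (outside ∷_) (allSubsets k) ++ map (inside ∷_) (allSubsets k)

isEmptyB : ∀ {k} → Subset k → Bool
isEmptyB [] = true
isEmptyB (inside ∷ s) = false
isEmptyB (outside ∷ s) = isEmptyB s

⋂[_] : ∀ {k n} → (Fin k → Subset n) → Subset k → Subset n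
⋂[ F ] [] = ⊤
⋂[ F ] (inside ∷ s) = F zero ∩ ⋂[ (λ i → F (suc i)) ] s
⋂[ F ] (outside ∷ s) = ⋂[ (λ i → F (suc i)) ] s

⋃[_] : ∀ {k n} → (Fin k → Subset n) → Subset n
⋃[_] {zero} F = ⊥
⋃[_] {suc k} F = F zero ∪ ⋃[ (λ i → F (suc i)) ]

F[_]_ : ∀ {k n} → (Fin k → Subset n) → Subset k → Subset n
F[ F ] S = if isEmptyB S then ⋃[ F ] else ⋂[ F ] S

sign : ℕ → ℤ → ℤ
sign zero z = z
sign (suc m) z = - sign m z

-- Δ(C) = Σ_{S ⊆ I} (-1)^{|S|} r(F_S), with I = Fin k
Δ : ∀ {n k} → Matroid n → (Fin k → Subset n) → ℤ
Δ {k = k} M F = foldr (λ S acc → sign ∣ S ∣ (+ rank M (F[ F ] S)) + acc) (+ 0) (allSubsets k)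

-- If x is a coloop of F_i (x ∈ F_i and r(F_i ∖ x) < r(F_i)), deleting x from F_i leaves a
-- flat and does not decrease Δ; as the total rank drops, repeating this ends with cyclic flats.
-- For S ≠ ∅, x is also a coloop of F_S ⊆ F_i whenever i ∈ S and x ∈ F_S, so r(F_S) drops by
-- [i ∈ S, x ∈ F_S]. Summed with signs these drops add [no F_j with j ≠ i contains x] to Δ,
-- which pays for the drop of r(⋃ F) by at most one, the union losing x only in that case.
module Submission where

open import Defs
open import Algebra.Bundles using (CommutativeMonoid)
import Algebra.Properties.CommutativeSemigroup as CommutativeSemigroupProperties
open import Data.Bool using (Bool; true; false; not; _∧_)
open import Data.Bool.Properties using (∧-zeroʳ)
open import Data.Empty using (⊥-elim)
open import Data.Fin using (Fin; zero; suc; _≟_)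
open import Data.Fin.Properties using (any?; suc-injective)
open import Data.Fin.Subset using (Subset; inside; outside; ⊥; _∈_; _∉_; _⊆_; _∩_; _∪_; ∁; ⁅_⁆; ∣_∣)
open import Data.Fin.Subset.Properties
  using ( _∈?_; ∉⊥; ⊆-antisym; ∣⁅x⁆∣≡1; x∈⁅x⁆; x≢y⇒x∉⁅y⁆; x∉⁅y⁆⇒x≢y; x∈∁p⇒x∉p; x∉p⇒x∈∁p
        ; x∈p∩q⁺; x∈p∩q⁻; x∈p∪q⁻; p∩q⊆p; p∩q⊆q; p⊆p∪q; q⊆p∪q; ∩-assoc; ∩-commutativeMonoid )
open import Data.Integer using (ℤ; +_; -_; _+_; _-_; _≤_; +≤+)
import Data.Integer.Properties as ℤP
open import Data.Integer.Tactic.RingSolver using (solve-∀)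
open import Data.List using (_++_; map; foldr)
open import Data.List.Properties using (foldr-++; foldr-map; foldr-cong)
open import Data.Nat as ℕ using (ℕ; zero; suc; _<_)
import Data.Nat.Properties as ℕP
open import Data.Nat.Induction using (<-wellFounded)
open import Algebra.Properties.Monoid.Sum ℕP.+-0-monoid using (sum; sum-cong-≗)
open import Data.Product using (Σ; ∃; _×_; _,_; proj₁)
open import Data.Sum using (inj₁; inj₂)
open import Data.Vec using ([]; _∷_; lookup; here; there)
open import Data.Vec.Properties using ([]=⇒lookup; lookup⇒[]=; lookup-zipWith; lookup-replicate)
open import Data.Vec.Functional using (updateAt)
open import Data.Vec.Functional.Properties using (updateAt-updates; updateAt-minimal)
open import Function using (_∘_)
open import Induction.WellFounded using (Acc; acc)
open import Relation.Binary.PropositionalEquality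
open import Relation.Nullary using (¬_; Dec; yes; no)
open import Relation.Nullary.Decidable using (_×-dec_)

alternatingSum : ∀ k → (Subset k → ℤ) → ℤ
alternatingSum zero    g = g []
alternatingSum (suc k) g = alternatingSum k (g ∘ (outside ∷_)) - alternatingSum k (g ∘ (inside ∷_))

alternatingSum-cong : ∀ k {g h : Subset k → ℤ} → (∀ S → g S ≡ h S) → alternatingSum k g ≡ alternatingSum k h
alternatingSum-cong zero    g≗h = g≗h []
alternatingSum-cong (suc k) g≗h =
  cong₂ _-_ (alternatingSum-cong k (g≗h ∘ (outside ∷_))) (alternatingSum-cong k (g≗h ∘ (inside ∷_)))

alternatingSum-zero : ∀ k → alternatingSum k (λ _ → + 0) ≡ + 0
alternatingSum-zero zero    = refl
alternatingSum-zero (suc k) = cong₂ _-_ (alternatingSum-zero k) (alternatingSum-zero k)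

alternatingSum-neg : ∀ k (g : Subset k → ℤ) → alternatingSum k (λ S → - g S) ≡ - alternatingSum k g
alternatingSum-neg zero    g = refl
alternatingSum-neg (suc k) g =
  trans (cong₂ _-_ (alternatingSum-neg k _) (alternatingSum-neg k _))
        (neg-distrib-minus (alternatingSum k (g ∘ (outside ∷_))) (alternatingSum k (g ∘ (inside ∷_))))
  where
  neg-distrib-minus : ∀ a b → - a - - b ≡ - (a - b)
  neg-distrib-minus = solve-∀

alternatingSum-+ : ∀ k (g h : Subset k → ℤ) →
  alternatingSum k (λ S → g S + h S) ≡ alternatingSum k g + alternatingSum k h
alternatingSum-+ zero    g h = refl
alternatingSum-+ (suc k) g h =
  trans (cong₂ _-_ (alternatingSum-+ k _ _) (alternatingSum-+ k _ _))
        (interchange (Σout g) (Σout h) (Σin g) (Σin h))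
  where
  Σout Σin : (Subset (suc k) → ℤ) → ℤ
  Σout g = alternatingSum k (g ∘ (outside ∷_))
  Σin  g = alternatingSum k (g ∘ (inside ∷_))
  interchange : ∀ a b c d → (a + b) - (c + d) ≡ (a - c) + (b - d)
  interchange = solve-∀

-- Needed because F_∅ is the union of the family, not an intersection.
alternatingSum-agreeing-off-⊥ : ∀ k (g h : Subset k → ℤ) → (∀ S → isEmptyB S ≡ false → g S ≡ h S) →
  alternatingSum k g + h ⊥ ≡ alternatingSum k h + g ⊥
alternatingSum-agreeing-off-⊥ zero    g h _   = ℤP.+-comm (g []) (h [])
alternatingSum-agreeing-off-⊥ (suc k) g h g≐h = begin
  Σout g - Σin g + h ⊥  ≡⟨ swap (Σout g) (Σin g) (h ⊥) ⟩
  Σout g + h ⊥ - Σin g  ≡⟨ cong₂ _-_ (alternatingSum-agreeing-off-⊥ k _ _ (g≐h ∘ (outside ∷_)))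
                                     (alternatingSum-cong k (λ S → g≐h (inside ∷ S) refl)) ⟩
  Σout h + g ⊥ - Σin h  ≡⟨ sym (swap (Σout h) (Σin h) (g ⊥)) ⟩
  Σout h - Σin h + g ⊥  ∎
  where
  open ≡-Reasoning
  Σout Σin : (Subset (suc k) → ℤ) → ℤ
  Σout g = alternatingSum k (g ∘ (outside ∷_))
  Σin  g = alternatingSum k (g ∘ (inside ∷_))
  swap : ∀ a b c → a - b + c ≡ a + c - b
  swap = solve-∀

sign-neg : ∀ m z → sign m (- z) ≡ - sign m z
sign-neg zero    z = refl
sign-neg (suc m) z = cong -_ (sign-neg m z)

foldr-signed-allSubsets : ∀ k (g : Subset k → ℤ) a →
  foldr (λ S acc → sign ∣ S ∣ (g S) + acc) a (allSubsets k) ≡ alternatingSum k g + a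
foldr-signed-allSubsets zero    g a = refl
foldr-signed-allSubsets (suc k) g a = begin
  foldr step a (map (outside ∷_) Ss ++ map (inside ∷_) Ss)
    ≡⟨ foldr-++ step a (map (outside ∷_) Ss) _ ⟩
  foldr step (foldr step a (map (inside ∷_) Ss)) (map (outside ∷_) Ss)
    ≡⟨ foldr-map step (outside ∷_) _ Ss ⟩
  foldr (λ S acc → sign ∣ S ∣ (g (outside ∷ S)) + acc) (foldr step a (map (inside ∷_) Ss)) Ss
    ≡⟨ foldr-signed-allSubsets k _ _ ⟩
  alternatingSum k (g ∘ (outside ∷_)) + foldr step a (map (inside ∷_) Ss)
    ≡⟨ cong (λ z → alternatingSum k (g ∘ (outside ∷_)) + z) (begin
         foldr step a (map (inside ∷_) Ss)
           ≡⟨ foldr-map step (inside ∷_) a Ss ⟩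
         foldr (λ S acc → - sign ∣ S ∣ (g (inside ∷ S)) + acc) a Ss
           ≡⟨ foldr-cong (λ S acc → cong (_+ acc) (sym (sign-neg ∣ S ∣ _))) refl Ss ⟩
         foldr (λ S acc → sign ∣ S ∣ (- g (inside ∷ S)) + acc) a Ss
           ≡⟨ foldr-signed-allSubsets k _ a ⟩
         alternatingSum k (λ S → - g (inside ∷ S)) + a
           ≡⟨ cong (_+ a) (alternatingSum-neg k _) ⟩
         - alternatingSum k (g ∘ (inside ∷_)) + a ∎) ⟩
  alternatingSum k (g ∘ (outside ∷_)) + (- alternatingSum k (g ∘ (inside ∷_)) + a)
    ≡⟨ sym (ℤP.+-assoc (alternatingSum k (g ∘ (outside ∷_))) (- alternatingSum k (g ∘ (inside ∷_))) a) ⟩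
  alternatingSum (suc k) g + a ∎
  where
  open ≡-Reasoning
  Ss = allSubsets k
  step = λ S acc → sign ∣ S ∣ (g S) + acc

Δ≡alternatingSum : ∀ {n k} (M : Matroid n) (F : Fin k → Subset n) →
  Δ M F ≡ alternatingSum k (λ S → + rank M (F[ F ] S))
Δ≡alternatingSum {k = k} M F = trans (foldr-signed-allSubsets k _ (+ 0)) (ℤP.+-identityʳ _)

ind : Bool → ℕ
ind true  = 1
ind false = 0

allᵇ : ∀ {k} → (Fin k → Bool) → Subset k → Bool
allᵇ P []            = true
allᵇ P (outside ∷ S) = allᵇ (P ∘ suc) S
allᵇ P (inside  ∷ S) = P zero ∧ allᵇ (P ∘ suc) S

noneᵇ : ∀ {k} → (Fin k → Bool) → Bool
noneᵇ {zero}  P = true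
noneᵇ {suc k} P = not (P zero) ∧ noneᵇ (P ∘ suc)

allButᵇ : ∀ {k} → Fin k → (Fin k → Bool) → Subset k → Bool
allButᵇ zero    P (outside ∷ S) = false
allButᵇ zero    P (inside  ∷ S) = allᵇ (P ∘ suc) S
allButᵇ (suc i) P (outside ∷ S) = allButᵇ i (P ∘ suc) S
allButᵇ (suc i) P (inside  ∷ S) = P zero ∧ allButᵇ i (P ∘ suc) S

noneButᵇ : ∀ {k} → Fin k → (Fin k → Bool) → Bool
noneButᵇ zero    P = noneᵇ (P ∘ suc)
noneButᵇ (suc i) P = not (P zero) ∧ noneButᵇ i (P ∘ suc)

alternatingSum-allᵇ : ∀ k (P : Fin k → Bool) →
  alternatingSum k (λ S → + ind (allᵇ P S)) ≡ + ind (noneᵇ P)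
alternatingSum-allᵇ zero    P = refl
alternatingSum-allᵇ (suc k) P with P zero
... | true  = ℤP.+-inverseʳ (alternatingSum k (λ S → + ind (allᵇ (P ∘ suc) S)))
... | false = trans (cong₂ _-_ (alternatingSum-allᵇ k (P ∘ suc)) (alternatingSum-zero k)) (ℤP.+-identityʳ _)

alternatingSum-allButᵇ : ∀ k (i : Fin k) (P : Fin k → Bool) →
  alternatingSum k (λ S → + ind (allButᵇ i P S)) ≡ - + ind (noneButᵇ i P)
alternatingSum-allButᵇ (suc k) zero P =
  trans (cong₂ _-_ (alternatingSum-zero k) (alternatingSum-allᵇ k (P ∘ suc))) (ℤP.+-identityˡ _)
alternatingSum-allButᵇ (suc k) (suc i) P with P zero
... | true  = ℤP.+-inverseʳ (alternatingSum k (λ S → + ind (allButᵇ i (P ∘ suc) S)))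
... | false =
  trans (cong₂ _-_ (alternatingSum-allButᵇ k i (P ∘ suc)) (alternatingSum-zero k)) (ℤP.+-identityʳ _)

allButᵇ-⊥ : ∀ {k} (i : Fin k) P → allButᵇ i P ⊥ ≡ false
allButᵇ-⊥ zero    P = refl
allButᵇ-⊥ (suc i) P = allButᵇ-⊥ i (P ∘ suc)

allButᵇ≡lookup∧allᵇ : ∀ {k} (i : Fin k) P S → P i ≡ true → allButᵇ i P S ≡ lookup S i ∧ allᵇ P S
allButᵇ≡lookup∧allᵇ zero    P (outside ∷ S) Pi = refl
allButᵇ≡lookup∧allᵇ zero    P (inside  ∷ S) Pi rewrite Pi = refl
allButᵇ≡lookup∧allᵇ (suc i) P (outside ∷ S) Pi = allButᵇ≡lookup∧allᵇ i (P ∘ suc) S Pi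
allButᵇ≡lookup∧allᵇ (suc i) P (inside  ∷ S) Pi with P zero
... | true  = allButᵇ≡lookup∧allᵇ i (P ∘ suc) S Pi
... | false = sym (∧-zeroʳ (lookup S i))

noneᵇ≡false : ∀ {k} (P : Fin k → Bool) → noneᵇ P ≡ false → ∃ λ j → P j ≡ true
noneᵇ≡false {suc k} P none≡false with P zero in P0
... | true  = zero , P0
... | false = let j , Pj = noneᵇ≡false (P ∘ suc) none≡false in suc j , Pj

noneButᵇ≡false : ∀ {k} (i : Fin k) P → noneButᵇ i P ≡ false → ∃ λ j → j ≢ i × P j ≡ true
noneButᵇ≡false zero P none≡false = let j , Pj = noneᵇ≡false (P ∘ suc) none≡false in suc j , (λ ()) , Pj
noneButᵇ≡false (suc i) P none≡false with P zero in P0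
... | true  = zero , (λ ()) , P0
... | false = let j , j≢i , Pj = noneButᵇ≡false i (P ∘ suc) none≡false in suc j , j≢i ∘ suc-injective , Pj

infixl 8 _∖_

-- The form used in IsCyclic; the library's p - x unfolds to p ─ ⁅ x ⁆ instead.
_∖_ : ∀ {n} → Subset n → Fin n → Subset n
A ∖ x = A ∩ ∁ ⁅ x ⁆

module _ {n : ℕ} {A : Subset n} {x : Fin n} where

  ∈∖⁺ : ∀ {y} → y ∈ A → y ≢ x → y ∈ A ∖ x
  ∈∖⁺ y∈A y≢x = x∈p∩q⁺ (y∈A , x∉p⇒x∈∁p (x≢y⇒x∉⁅y⁆ y≢x))

  ∈∖⁻ : ∀ {y} → y ∈ A ∖ x → y ∈ A × y ≢ x
  ∈∖⁻ y∈A∖x = let y∈A , y∈∁x = x∈p∩q⁻ A _ y∈A∖x in y∈A , x∉⁅y⁆⇒x≢y (x∈∁p⇒x∉p y∈∁x)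

  ∖-⊆ : A ∖ x ⊆ A
  ∖-⊆ = p∩q⊆p A _

  ⊆-∖-∪-⁅⁆ : A ⊆ A ∖ x ∪ ⁅ x ⁆
  ⊆-∖-∪-⁅⁆ {y} y∈A with y ≟ x
  ... | yes refl = q⊆p∪q (A ∖ x) ⁅ x ⁆ (x∈⁅x⁆ x)
  ... | no y≢x   = p⊆p∪q ⁅ x ⁆ (∈∖⁺ y∈A y≢x)

  ∖-∉ : x ∉ A → A ∖ x ≡ A
  ∖-∉ x∉A = ⊆-antisym ∖-⊆ λ y∈A → ∈∖⁺ y∈A λ { refl → x∉A y∈A }

lookup≡false⇒∉ : ∀ {n} {A : Subset n} {x} → lookup A x ≡ false → x ∉ A
lookup≡false⇒∉ A[x]≡false x∈A with trans (sym ([]=⇒lookup x∈A)) A[x]≡false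
... | ()

updateAt-preserves : ∀ {A : Set} (P : A → Set) {k} (F : Fin k → A) i {f : A → A} →
  (P (F i) → P (f (F i))) → ∀ j → P (F j) → P (updateAt F i f j)
updateAt-preserves P F i Pf j PFj with j ≟ i
... | yes refl = subst P (sym (updateAt-updates i F)) (Pf PFj)
... | no j≢i   = subst P (sym (updateAt-minimal j i F j≢i)) PFj

isEmptyB-⊥ : ∀ k → isEmptyB (⊥ {k}) ≡ true
isEmptyB-⊥ zero    = refl
isEmptyB-⊥ (suc k) = isEmptyB-⊥ k

module _ {k n : ℕ} where

  F[]-⊥ : (F : Fin k → Subset n) → F[ F ] ⊥ ≡ ⋃[ F ]
  F[]-⊥ F rewrite isEmptyB-⊥ k = refl

  F[]-nonempty : (F : Fin k → Subset n) {S : Subset k} → isEmptyB S ≡ false → F[ F ] S ≡ ⋂[ F ] S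
  F[]-nonempty F nonempty rewrite nonempty = refl

⋂-⊆ : ∀ {k n} (F : Fin k → Subset n) {i S} → i ∈ S → ⋂[ F ] S ⊆ F i
⋂-⊆ F here = p∩q⊆p (F zero) _
⋂-⊆ F {S = outside ∷ S} (there i∈S) = ⋂-⊆ (F ∘ suc) i∈S
⋂-⊆ F {S = inside  ∷ S} (there i∈S) = ⋂-⊆ (F ∘ suc) i∈S ∘ p∩q⊆q (F zero) _

⋂-updateAt-∉ : ∀ {k n} (F : Fin k → Subset n) {i S} {f : Subset n → Subset n} →
  i ∉ S → ⋂[ updateAt F i f ] S ≡ ⋂[ F ] S
⋂-updateAt-∉ F {zero}  {outside ∷ S} i∉S = refl
⋂-updateAt-∉ F {zero}  {inside  ∷ S} i∉S = ⊥-elim (i∉S here)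
⋂-updateAt-∉ F {suc i} {outside ∷ S} i∉S = ⋂-updateAt-∉ (F ∘ suc) (i∉S ∘ there)
⋂-updateAt-∉ F {suc i} {inside  ∷ S} i∉S = cong (F zero ∩_) (⋂-updateAt-∉ (F ∘ suc) (i∉S ∘ there))

⋂-updateAt-∈ : ∀ {k n} (F : Fin k → Subset n) {i S} (B : Subset n) →
  i ∈ S → ⋂[ updateAt F i (_∩ B) ] S ≡ ⋂[ F ] S ∩ B
⋂-updateAt-∈ {n = n} F B here = xy∙z≈xz∙y (F zero) B _
  where open CommutativeSemigroupProperties (CommutativeMonoid.commutativeSemigroup (∩-commutativeMonoid n))
⋂-updateAt-∈ F {S = outside ∷ S} B (there i∈S) = ⋂-updateAt-∈ (F ∘ suc) B i∈S
⋂-updateAt-∈ F {S = inside  ∷ S} B (there i∈S) =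
  trans (cong (F zero ∩_) (⋂-updateAt-∈ (F ∘ suc) B i∈S)) (sym (∩-assoc (F zero) _ B))

allᵇ-lookup≡lookup-⋂ : ∀ {k n} (F : Fin k → Subset n) x S → allᵇ (λ j → lookup (F j) x) S ≡ lookup (⋂[ F ] S) x
allᵇ-lookup≡lookup-⋂ F x []            = sym (lookup-replicate x inside)
allᵇ-lookup≡lookup-⋂ F x (outside ∷ S) = allᵇ-lookup≡lookup-⋂ (F ∘ suc) x S
allᵇ-lookup≡lookup-⋂ F x (inside  ∷ S) =
  trans (cong (lookup (F zero) x ∧_) (allᵇ-lookup≡lookup-⋂ (F ∘ suc) x S))
        (sym (lookup-zipWith _∧_ x (F zero) _))

∈⋃⁺ : ∀ {k n} (F : Fin k → Subset n) j {y} → y ∈ F j → y ∈ ⋃[ F ]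
∈⋃⁺ F zero    y∈Fj = p⊆p∪q _ y∈Fj
∈⋃⁺ F (suc j) y∈Fj = q⊆p∪q (F zero) _ (∈⋃⁺ (F ∘ suc) j y∈Fj)

∈⋃⁻ : ∀ {k n} (F : Fin k → Subset n) {y} → y ∈ ⋃[ F ] → ∃ λ j → y ∈ F j
∈⋃⁻ {zero}  F y∈⋃ = ⊥-elim (∉⊥ y∈⋃)
∈⋃⁻ {suc k} F y∈⋃ with x∈p∪q⁻ (F zero) _ y∈⋃
... | inj₁ y∈F0 = zero , y∈F0
... | inj₂ y∈⋃′ = let j , y∈Fj = ∈⋃⁻ (F ∘ suc) y∈⋃′ in suc j , y∈Fj

∈⋃-updateAt-∖ : ∀ {k n} (F : Fin k → Subset n) i {x y} → y ∈ ⋃[ F ] → y ≢ x → y ∈ ⋃[ updateAt F i (_∖ x) ]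
∈⋃-updateAt-∖ F i y∈⋃ y≢x =
  let j , y∈Fj = ∈⋃⁻ F y∈⋃ in ∈⋃⁺ _ j (updateAt-preserves (_ ∈_) F i (λ y∈Fi → ∈∖⁺ y∈Fi y≢x) j y∈Fj)

module _ {n : ℕ} (M : Matroid n) where

  IsColoop : Subset n → Fin n → Set
  IsColoop F x = x ∈ F × rank M (F ∖ x) < rank M F

  isColoop? : ∀ F x → Dec (IsColoop F x)
  isColoop? F x = x ∈? F ×-dec rank M (F ∖ x) ℕP.<? rank M F

  rank-∪-⁅⁆ : ∀ X x → rank M (X ∪ ⁅ x ⁆) ℕ.≤ suc (rank M X)
  rank-∪-⁅⁆ X x = begin
    rank M (X ∪ ⁅ x ⁆)                          ≤⟨ ℕP.m≤m+n _ _ ⟩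
    rank M (X ∪ ⁅ x ⁆) ℕ.+ rank M (X ∩ ⁅ x ⁆)  ≤⟨ rank-submod M X ⁅ x ⁆ ⟩
    rank M X ℕ.+ rank M ⁅ x ⁆                   ≤⟨ ℕP.+-monoʳ-≤ (rank M X) rank⁅x⁆≤1 ⟩
    rank M X ℕ.+ 1                              ≡⟨ ℕP.+-comm (rank M X) 1 ⟩
    suc (rank M X)                              ∎
    where
    open ℕP.≤-Reasoning
    rank⁅x⁆≤1 : rank M ⁅ x ⁆ ℕ.≤ 1
    rank⁅x⁆≤1 = subst (rank M ⁅ x ⁆ ℕ.≤_) (∣⁅x⁆∣≡1 x) (rank-≤card M ⁅ x ⁆)

  submodular-< : ∀ {U V X Y} → U ⊆ X ∪ Y → V ⊆ X ∩ Y → rank M Y < rank M U → rank M V < rank M X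
  submodular-< {U} {V} {X} {Y} U⊆X∪Y V⊆X∩Y Y<U = ℕP.+-cancelʳ-≤ (rank M Y) (suc (rank M V)) (rank M X) (begin
    suc (rank M V ℕ.+ rank M Y)                ≡⟨ sym (ℕP.+-suc (rank M V) (rank M Y)) ⟩
    rank M V ℕ.+ suc (rank M Y)                ≤⟨ ℕP.+-monoʳ-≤ (rank M V) Y<U ⟩
    rank M V ℕ.+ rank M U                      ≡⟨ ℕP.+-comm (rank M V) (rank M U) ⟩
    rank M U ℕ.+ rank M V                      ≤⟨ ℕP.+-mono-≤ (rank-mono M U⊆X∪Y) (rank-mono M V⊆X∩Y) ⟩
    rank M (X ∪ Y) ℕ.+ rank M (X ∩ Y)          ≤⟨ rank-submod M X Y ⟩
    rank M X ℕ.+ rank M Y                      ∎)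
    where open ℕP.≤-Reasoning

  rank-coloop : ∀ {A x} → IsColoop A x → rank M A ≡ suc (rank M (A ∖ x))
  rank-coloop {A} {x} (_ , drop) =
    ℕP.≤-antisym (ℕP.≤-trans (rank-mono M ⊆-∖-∪-⁅⁆) (rank-∪-⁅⁆ (A ∖ x) x)) drop

  IsColoop-⊆ : ∀ {A F x} → IsColoop F x → A ⊆ F → x ∈ A → IsColoop A x
  IsColoop-⊆ {A} {F} {x} (_ , drop) A⊆F x∈A = x∈A , submodular-< F⊆A∪F∖x A∖x⊆A∩F∖x drop
    where
    F⊆A∪F∖x : F ⊆ A ∪ F ∖ x
    F⊆A∪F∖x {y} y∈F with y ≟ x
    ... | yes refl = p⊆p∪q (F ∖ x) x∈A
    ... | no y≢x   = q⊆p∪q A (F ∖ x) (∈∖⁺ y∈F y≢x)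
    A∖x⊆A∩F∖x : A ∖ x ⊆ A ∩ F ∖ x
    A∖x⊆A∩F∖x y∈A∖x = let y∈A , y≢x = ∈∖⁻ y∈A∖x in x∈p∩q⁺ (y∈A , ∈∖⁺ (A⊆F y∈A) y≢x)

  IsFlat-∖-coloop : ∀ {F x} → IsFlat M F → IsColoop F x → IsFlat M (F ∖ x)
  IsFlat-∖-coloop {F} {x} flat (_ , drop) y y∉F∖x with y ≟ x
  ... | yes refl = ℕP.<-≤-trans drop (rank-mono M ⊆-∖-∪-⁅⁆)
  ... | no y≢x   = submodular-< F∪y⊆X∪F F∖x⊆X∩F (flat y (y∉F∖x ∘ λ y∈F → ∈∖⁺ y∈F y≢x))
    where
    X = F ∖ x ∪ ⁅ y ⁆
    F∪y⊆X∪F : F ∪ ⁅ y ⁆ ⊆ X ∪ F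
    F∪y⊆X∪F z∈F∪y with x∈p∪q⁻ F ⁅ y ⁆ z∈F∪y
    ... | inj₁ z∈F = q⊆p∪q X F z∈F
    ... | inj₂ z∈y = p⊆p∪q F (q⊆p∪q (F ∖ x) ⁅ y ⁆ z∈y)
    F∖x⊆X∩F : F ∖ x ⊆ X ∩ F
    F∖x⊆X∩F z∈F∖x = x∈p∩q⁺ (p⊆p∪q ⁅ y ⁆ z∈F∖x , ∖-⊆ z∈F∖x)

  noColoop⇒IsCyclic : ∀ {F} → (∀ x → ¬ IsColoop F x) → IsCyclic M F
  noColoop⇒IsCyclic noColoop x x∈F =
    ℕP.≤-antisym (rank-mono M ∖-⊆) (ℕP.≮⇒≥ λ drop → noColoop x (x∈F , drop))

≤-of-balance : ∀ {a b : ℤ} {c d o : ℕ} → a + + d ≡ (- + o + b) + + c → c ℕ.≤ o ℕ.+ d → a ≤ b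
≤-of-balance {a} {b} {c} {d} {o} balance c≤o+d = begin
  a                               ≡⟨ add-sub a (+ d) ⟩
  a + + d - + d                   ≡⟨ cong (_- + d) balance ⟩
  (- + o + b) + + c - + d         ≤⟨ ℤP.+-monoˡ-≤ (- + d) (ℤP.+-monoʳ-≤ (- + o + b) (+≤+ c≤o+d)) ⟩
  (- + o + b) + (+ o + + d) - + d ≡⟨ cancel (+ o) b (+ d) ⟩
  b                               ∎
  where
  open ℤP.≤-Reasoning
  add-sub : ∀ a d → a ≡ a + d - d
  add-sub = solve-∀
  cancel : ∀ o b d → (- o + b) + (o + d) - d ≡ b
  cancel = solve-∀

module _ {n : ℕ} (M : Matroid n) {k : ℕ} (F : Fin k → Subset n) {i : Fin k} {x : Fin n}
         (coloop : IsColoop M (F i) x) where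

  private
    G : Fin k → Subset n
    G = updateAt F i (_∖ x)

    x∈F : Fin k → Bool
    x∈F j = lookup (F j) x

  allButᵇ-x∈F : ∀ S → allButᵇ i x∈F S ≡ lookup S i ∧ lookup (⋂[ F ] S) x
  allButᵇ-x∈F S = trans (allButᵇ≡lookup∧allᵇ i x∈F S ([]=⇒lookup (proj₁ coloop)))
                        (cong (lookup S i ∧_) (allᵇ-lookup≡lookup-⋂ F x S))

  rank-⋂-deleteColoop : ∀ S → rank M (⋂[ F ] S) ≡ ind (lookup S i ∧ lookup (⋂[ F ] S) x) ℕ.+ rank M (⋂[ G ] S)
  rank-⋂-deleteColoop S with lookup S i in i∈S | lookup (⋂[ F ] S) x in x∈⋂
  ... | true  | true  = begin
    rank M (⋂[ F ] S)           ≡⟨ rank-coloop M (IsColoop-⊆ M coloop (⋂-⊆ F i∈S′) (lookup⇒[]= x _ x∈⋂)) ⟩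
    suc (rank M (⋂[ F ] S ∖ x)) ≡⟨ cong (suc ∘ rank M) (sym (⋂-updateAt-∈ F _ i∈S′)) ⟩
    suc (rank M (⋂[ G ] S))     ∎
    where
    open ≡-Reasoning
    i∈S′ = lookup⇒[]= i S i∈S
  ... | true  | false =
    cong (rank M) (sym (trans (⋂-updateAt-∈ F _ (lookup⇒[]= i S i∈S)) (∖-∉ (lookup≡false⇒∉ x∈⋂))))
  ... | false | _     = cong (rank M) (sym (⋂-updateAt-∉ F {S = S} (lookup≡false⇒∉ i∈S)))

  rank-⋃-deleteColoop : rank M ⋃[ F ] ℕ.≤ ind (noneButᵇ i x∈F) ℕ.+ rank M ⋃[ G ]
  rank-⋃-deleteColoop with noneButᵇ i x∈F in none
  ... | true  = ℕP.≤-trans (rank-mono M ⋃F⊆⋃G∪x) (rank-∪-⁅⁆ M ⋃[ G ] x)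
    where
    ⋃F⊆⋃G∪x : ⋃[ F ] ⊆ ⋃[ G ] ∪ ⁅ x ⁆
    ⋃F⊆⋃G∪x {y} y∈⋃ with y ≟ x
    ... | yes refl = q⊆p∪q ⋃[ G ] ⁅ x ⁆ (x∈⁅x⁆ x)
    ... | no y≢x   = p⊆p∪q ⁅ x ⁆ (∈⋃-updateAt-∖ F i y∈⋃ y≢x)
  ... | false = rank-mono M ⋃F⊆⋃G
    where
    ⋃F⊆⋃G : ⋃[ F ] ⊆ ⋃[ G ]
    ⋃F⊆⋃G {y} y∈⋃ with y ≟ x
    ... | no y≢x   = ∈⋃-updateAt-∖ F i y∈⋃ y≢x
    ... | yes refl =
      let j , j≢i , x∈Fj = noneButᵇ≡false i x∈F none
      in ∈⋃⁺ G j (subst (x ∈_) (sym (updateAt-minimal j i F j≢i)) (lookup⇒[]= x (F j) x∈Fj))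

  Δ-deleteColoop : Δ M F + + rank M ⋃[ G ] ≡ (- + ind (noneButᵇ i x∈F) + Δ M G) + + rank M ⋃[ F ]
  Δ-deleteColoop = begin
    Δ M F + + rank M ⋃[ G ]
      ≡⟨ cong₂ _+_ (Δ≡alternatingSum M F) (sym c+g-at-⊥) ⟩
    alternatingSum k f + (c ⊥ + g ⊥)
      ≡⟨ alternatingSum-agreeing-off-⊥ k f (λ S → c S + g S) f≡c+g ⟩
    alternatingSum k (λ S → c S + g S) + f ⊥
      ≡⟨ cong₂ _+_ (alternatingSum-+ k c g) (cong (+_ ∘ rank M) (F[]-⊥ F)) ⟩
    alternatingSum k c + alternatingSum k g + + rank M ⋃[ F ]
      ≡⟨ cong (_+ _) (cong₂ _+_ (alternatingSum-allButᵇ k i x∈F) (sym (Δ≡alternatingSum M G))) ⟩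
    - + ind (noneButᵇ i x∈F) + Δ M G + + rank M ⋃[ F ] ∎
    where
    open ≡-Reasoning
    f g c : Subset k → ℤ
    f S = + rank M (F[ F ] S)
    g S = + rank M (F[ G ] S)
    c S = + ind (allButᵇ i x∈F S)
    c+g-at-⊥ : c ⊥ + g ⊥ ≡ + rank M ⋃[ G ]
    c+g-at-⊥ = trans (cong₂ _+_ (cong (+_ ∘ ind) (allButᵇ-⊥ i x∈F)) (cong (+_ ∘ rank M) (F[]-⊥ G)))
                     (ℤP.+-identityˡ _)
    f≡c+g : ∀ S → isEmptyB S ≡ false → f S ≡ c S + g S
    f≡c+g S nonempty = begin
      + rank M (F[ F ] S)
        ≡⟨ cong (+_ ∘ rank M) (F[]-nonempty F {S} nonempty) ⟩
      + rank M (⋂[ F ] S)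
        ≡⟨ cong +_ (rank-⋂-deleteColoop S) ⟩
      + ind (lookup S i ∧ lookup (⋂[ F ] S) x) + + rank M (⋂[ G ] S)
        ≡⟨ cong₂ (λ b A → + ind b + + rank M A) (sym (allButᵇ-x∈F S)) (sym (F[]-nonempty G {S} nonempty)) ⟩
      c S + g S ∎

  Δ-≤-deleteColoop : Δ M F ≤ Δ M G
  Δ-≤-deleteColoop = ≤-of-balance Δ-deleteColoop rank-⋃-deleteColoop

sum-< : ∀ {k} (f g : Fin k → ℕ) (i : Fin k) → g i < f i → (∀ j → j ≢ i → g j ≡ f j) → sum g < sum f
sum-< f g zero    gi<fi g≗f = ℕP.+-mono-<-≤ gi<fi (ℕP.≤-reflexive (sum-cong-≗ λ j → g≗f (suc j) λ ()))
sum-< f g (suc i) gi<fi g≗f =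
  ℕP.+-mono-≤-< (ℕP.≤-reflexive (g≗f zero λ ()))
                (sum-< (f ∘ suc) (g ∘ suc) i gi<fi λ j j≢i → g≗f (suc j) (j≢i ∘ suc-injective))

module _ {n : ℕ} (M : Matroid n) where

  totalRank : ∀ {k} → (Fin k → Subset n) → ℕ
  totalRank F = sum (rank M ∘ F)

  totalRank-deleteColoop : ∀ {k} {F : Fin k → Subset n} {i x} → IsColoop M (F i) x →
    totalRank (updateAt F i (_∖ x)) < totalRank F
  totalRank-deleteColoop {F = F} {i} {x} (_ , drop) =
    sum-< (rank M ∘ F) (rank M ∘ updateAt F i (_∖ x)) i
      (subst (λ A → rank M A < rank M (F i)) (sym (updateAt-updates i F)) drop)
      (λ j j≢i → cong (rank M) (updateAt-minimal j i F j≢i))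

  cyclicFlats-by-deletion : ∀ {k} (F : Fin k → Subset n) → Acc _<_ (totalRank F) → (∀ i → IsFlat M (F i)) →
    Σ (Fin k → Subset n) (λ F′ → (∀ i → IsCyclicFlat M (F′ i)) × (Δ M F ≤ Δ M F′))
  cyclicFlats-by-deletion F (acc smaller) flats with any? (λ i → any? (isColoop? M (F i)))
  ... | yes (i , x , coloop) =
    let F′ , cyclicFlats , Δ≤ = cyclicFlats-by-deletion (updateAt F i (_∖ x))
                                  (smaller (totalRank-deleteColoop {F = F} coloop)) flats′
    in F′ , cyclicFlats , ℤP.≤-trans (Δ-≤-deleteColoop M F coloop) Δ≤
    where
    flats′ : ∀ j → IsFlat M (updateAt F i (_∖ x) j)
    flats′ j = updateAt-preserves (IsFlat M) F i (λ flat → IsFlat-∖-coloop M flat coloop) j (flats j)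
  ... | no noColoop =
    F , (λ i → flats i , noColoop⇒IsCyclic M λ x coloop → noColoop (i , x , coloop)) , ℤP.≤-refl

proposition2 : ∀ {n} (M : Matroid n) (k : ℕ) (F : Fin k → Subset n)
    → (∀ i → IsFlat M (F i))
    → Σ (Fin k → Subset n) (λ F′ → (∀ i → IsCyclicFlat M (F′ i)) × (Δ M F ≤ Δ M F′))
proposition2 M k F flats = cyclicFlats-by-deletion M F (<-wellFounded _) flats
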